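{- Let $q\ge3$ and let $i,j,n$ be integers with $0\le i\le j\le n$ and $i+j\ge n$. Let $f:\Sigma_q^n\to\mathbb{R}$ be a uniform function with $f\in U_{[i,j]}(n,q)$ and $f\not\equiv0$. Then $|f|\ge 2^{n-j}(q-1)^{n-j}q^{i+j-n}$.
   Context: $\Sigma_q=\{0,1,\dots,q-1\}$. The Hamming graph $H(n,q)$ has vertex set $\Sigma_q^n$, two vertices being adjacent iff they differ in exactly one coordinate. A function $f:\Sigma_q^n\to\mathbb{R}$ is a $\lambda$-eigenfunction of $H(n,q)$ if $\lambda f(x)=\sum_{y\text{ adjacent to }x}f(y)$ for all $x$. $\lambda_t(n,q)=n(q-1)-qt$ and $U_t(n,q)$ is the space of $\lambda_t(n,q)$-eigenfunctions; for $i\le j$, $U_{[i,j]}(n,q)=U_i(n,q)\oplus\cdots\oplus U_j(n,q)$. $|f|$ is the number of $x$ with $f(x)\ne0$. For $r\in\{1,\dots,n\}$ and $k\in\Sigma_q$, $f^r_k:\Sigma_q^{n-1}\to\mathbb{R}$ is defined by $f^r_k(y_1,\dots,y_{n-1})=f(y_1,\dots,y_{r-1},k,y_r,\dots,y_{n-1})$. $f$ is called uniform if for every $r\in\{1,\dots,n\}$ there is $l(r)\in\Sigma_q$ such that $f^r_k=f^r_m$ for all $k,m\in\Sigma_q\setminus\{l(r)\}$.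
   Formalization: The function f and its eigenfunction components in $U_{[i,j]}(n,q)$ take values in ℚ rather than ℝ. -}

module Defs where

open import Data.Nat as ℕ using (ℕ; zero; suc; _∸_)
open import Data.Integer as ℤ using (ℤ; +_)
open import Data.Rational using (ℚ; 0ℚ; _/_; _+_; _*_)
open import Data.Rational.Properties using (_≟_)
open import Data.Fin using (Fin)
import Data.Fin.Properties as FinP
open import Data.Vec using (Vec; []; _∷_; insertAt)
open import Data.List as List using (List; []; _∷_; concatMap; map; filter; length; foldr)
open import Data.Product using (∃; _×_)
open import Data.Unit using (⊤)
open import Relation.Nullary using (¬_; ¬?)
open import Relation.Binary.PropositionalEquality using (_≡_; _≢_)

Word : ℕ → ℕ → Set
Word q n = Vec (Fin q) n

allFin : ∀ q → List (Fin q)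
allFin q = List.allFin q

allWords : ∀ q n → List (Word q n)
allWords q zero = [] ∷ []
allWords q (suc n) = concatMap (λ a → map (a ∷_) (allWords q n)) (allFin q)

hamming : ∀ {q n} → Word q n → Word q n → ℕ
hamming [] [] = zero
hamming (a ∷ x) (b ∷ y) with a FinP.≟ b
... | Relation.Nullary.yes _ = hamming x y
... | Relation.Nullary.no  _ = suc (hamming x y)

sumℚ : List ℚ → ℚ
sumℚ = foldr _+_ 0ℚ

neighbourSum : ∀ {q n} → (Word q n → ℚ) → Word q n → ℚ
neighbourSum {q} {n} f x =
  sumℚ (map f (filter (λ y → hamming x y ℕ.≟ 1) (allWords q n)))

IsEigenfunction : ∀ {q n} → ℚ → (Word q n → ℚ) → Set
IsEigenfunction λ′ f = ∀ x → λ′ * f x ≡ neighbourSum f x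

eigval : ℕ → ℕ → ℕ → ℚ
eigval n q t = ((+ (n ℕ.* (q ∸ 1))) ℤ.- (+ (q ℕ.* t))) / 1

InU : ∀ {q n} → ℕ → (Word q n → ℚ) → Set
InU {q} {n} t f = IsEigenfunction (eigval n q t) f

InUrange : ∀ {q n} → ℕ → ℕ → (Word q n → ℚ) → Set
InUrange {q} {n} i j f =
  ∃ λ (g : ℕ → Word q n → ℚ) →
    (∀ t → i ℕ.≤ t → t ℕ.≤ j → InU t (g t)) ×
    (∀ x → f x ≡ sumℚ (map (λ k → g (i ℕ.+ k) x) (List.upTo (suc (j ∸ i)))))

support : ∀ {q n} → (Word q n → ℚ) → ℕ
support {q} {n} f = length (filter (λ x → ¬? (f x ≟ 0ℚ)) (allWords q n))

restrict : ∀ {q n} → (Word q (suc n) → ℚ) → Fin (suc n) → Fin q → Word q n → ℚ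
restrict f r k y = f (insertAt y r k)

Uniform : ∀ {q n} → (Word q n → ℚ) → Set
Uniform {q} {zero} f = ⊤
Uniform {q} {suc n} f =
  ∀ (r : Fin (suc n)) → ∃ λ (l : Fin q) →
    ∀ (k m : Fin q) → k ≢ l → m ≢ l → ∀ y → restrict f r k y ≡ restrict f r m y

-- Write fᵃ for the restriction of f to the words with first letter a, S = Σₐ fᵃ and
-- Dₐᵦ = fᵃ - fᵇ. If f is a λ-eigenfunction of H(n+1,q), then S and Dₐᵦ are eigenfunctions
-- of H(n,q) with eigenvalues λ - (q-1) and λ + 1. As λₜ(n+1) - (q-1) = λₜ(n) and
-- λₜ₊₁(n+1) + 1 = λₜ(n), this maps U_[i,j](n+1,q) to U_[i,j](n,q), resp. U_[i-1,j-1](n,q),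
-- and shows by induction that H(n,q) has no eigenvalues besides λ₀(n), ..., λₙ(n).
--
-- Uniformity in the first coordinate gives a letter l with fᵃ = g for all a ≠ l; with
-- h = fˡ we get S = h + (q-1)g, D = h - g and |f| = |h| + (q-1)|g|, and S, D and S - D
-- are uniform again. By induction on n we show (2(q-1))^(n-j) q^i ≤ q^(n-j) |f| for all
-- i ≤ j ≤ n. If S = 0 then h = -(q-1)g and |f| = q|D|. If g = 0 then S = h = D lies in
-- U_[i,j] ∩ U_[i-1,j-1] = U_[i,j-1] and |f| = |S|. If j = n+1 then |S| ≤ |f|. Otherwise
-- S ∈ U_[i,j] and S - D = qg ∈ U_[i-1,j] are both nonzero, and 2(q-1) = q + (q-2)
-- combines their bounds via |S| ≤ |g| + |h|.

module Submission where

open import Defs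
open import Data.Nat using (ℕ; _≤_; _+_; _*_; _∸_; _^_)
open import Data.Rational using (ℚ; 0ℚ)
open import Relation.Nullary using (¬_)
open import Relation.Binary.PropositionalEquality using (_≡_)

open import Algebra.Bundles using (CommutativeMonoid)
import Algebra.Properties.Group as GroupProperties
open import Algebra.Structures using (IsCommutativeMonoid)
open import Data.Bool using (true; false; not; if_then_else_)
open import Data.Empty using (⊥-elim)
open import Data.Fin as Fin using (Fin; toℕ; punchIn)
import Data.Fin.Properties as Fin
open import Data.Integer as ℤ using (ℤ; +_)
import Data.Integer.Properties as ℤ
import Data.Integer.Tactic.RingSolver as ℤ
open import Data.List as List using (List; []; _∷_; _++_; map; filter; foldr; concatMap; tabulate)
import Data.List.Properties as List
open import Data.Nat as ℕ using (zero; suc; _<_)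
import Data.Nat.Coprimality as ℕ
import Data.Nat.Properties as ℕ
import Data.Nat.Tactic.RingSolver as ℕ
open import Data.Product using (_,_; proj₁; proj₂)
import Data.Rational as ℚ
import Data.Rational.Properties as ℚ
open import Data.Rational.Solver using (module +-*-Solver)
open import Data.Sum using (inj₁; inj₂)
open import Data.Unit using (tt)
open import Data.Vec using ([]; _∷_)
open import Function using (_∘_; const)
open import Level using (0ℓ)
open import Relation.Binary.PropositionalEquality
  using (refl; sym; trans; cong; cong₂; subst; subst₂; _≗_; _≢_; module ≡-Reasoning)
open import Relation.Nullary using (Dec; does; yes; no; ¬?)
open import Relation.Nullary.Decidable using (_×-dec_)

open +-*-Solver using (solve; _:=_; _:+_; _:*_; _:-_; :-_; con)

-- Finite sums

module Sums {A : Set} {_∙_ : A → A → A} {ε : A}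
            (isCommutativeMonoid : IsCommutativeMonoid _≡_ _∙_ ε) where

  open IsCommutativeMonoid isCommutativeMonoid using (assoc; identityˡ; identityʳ)
  open ≡-Reasoning

  commutativeMonoid : CommutativeMonoid 0ℓ 0ℓ
  commutativeMonoid = record { isCommutativeMonoid = isCommutativeMonoid }

  open import Algebra.Properties.CommutativeMonoid.Sum commutativeMonoid public
    using (sum; sum-cong-≗; ∑-distrib-+; ∑-comm; sum-replicate-zero)
  open import Algebra.Properties.CommutativeMonoid.Sum commutativeMonoid
    using (sum-remove)
  open import Algebra.Properties.CommutativeSemigroup
    (CommutativeMonoid.commutativeSemigroup commutativeMonoid)
    using (interchange; xy∙z≈zy∙x)

  sum-zero : ∀ {m} {v : Fin m → A} → (∀ a → v a ≡ ε) → sum v ≡ ε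
  sum-zero {m} v≗ε = trans (sum-cong-≗ v≗ε) (sum-replicate-zero m)

  sum-homo : (φ : A → A) → (∀ x y → φ (x ∙ y) ≡ φ x ∙ φ y) → φ ε ≡ ε →
             ∀ {m} (v : Fin m → A) → φ (sum v) ≡ sum (φ ∘ v)
  sum-homo φ φ-∙ φ-ε {zero}  v = φ-ε
  sum-homo φ φ-∙ φ-ε {suc m} v =
    trans (φ-∙ _ _) (cong (φ (v Fin.zero) ∙_) (sum-homo φ φ-∙ φ-ε (v ∘ Fin.suc)))

  sum-except : ∀ {m} (v : Fin (suc m) → A) (l : Fin (suc m)) {c : A} →
               (∀ a → a ≢ l → v a ≡ c) → sum v ≡ v l ∙ sum {m} (const c)
  sum-except v l v≡c =
    trans (sum-remove {i = l} v)
          (cong (v l ∙_) (sum-cong-≗ (λ a → v≡c (punchIn l a) (Fin.punchInᵢ≢i l a))))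

  sum-single : ∀ {m} (v : Fin (suc m) → A) (l : Fin (suc m)) →
               (∀ a → a ≢ l → v a ≡ ε) → sum v ≡ v l
  sum-single {m} v l v≡ε = begin
    sum v                   ≡⟨ sum-except v l v≡ε ⟩
    v l ∙ sum {m} (const ε) ≡⟨ cong (v l ∙_) (sum-replicate-zero m) ⟩
    v l ∙ ε                 ≡⟨ identityʳ (v l) ⟩
    v l                     ∎

  sum-swap-at : ∀ {m} (v w : Fin (suc m) → A) (a : Fin (suc m)) →
                (∀ b → b ≢ a → v b ≡ w b) → sum v ∙ w a ≡ sum w ∙ v a
  sum-swap-at v w a v≡w = begin
    sum v ∙ w a                             ≡⟨ cong (_∙ w a) (sum-remove {i = a} v) ⟩
    (v a ∙ sum (v ∘ punchIn a)) ∙ w a       ≡⟨ cong (λ r → (v a ∙ r) ∙ w a) rest ⟩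
    (v a ∙ sum (w ∘ punchIn a)) ∙ w a       ≡⟨ xy∙z≈zy∙x (v a) _ (w a) ⟩
    (w a ∙ sum (w ∘ punchIn a)) ∙ v a       ≡⟨ cong (_∙ v a) (sum-remove {i = a} w) ⟨
    sum w ∙ v a                             ∎
    where
      rest : sum (v ∘ punchIn a) ≡ sum (w ∘ punchIn a)
      rest = sum-cong-≗ (λ b → v≡w (punchIn a b) (Fin.punchInᵢ≢i a b))

  sumMap : {B : Set} → (B → A) → List B → A
  sumMap f xs = foldr _∙_ ε (map f xs)

  module _ {B : Set} where

    sumMap-cong : ∀ {f g : B → A} → f ≗ g → ∀ xs → sumMap f xs ≡ sumMap g xs
    sumMap-cong f≗g []       = refl
    sumMap-cong f≗g (x ∷ xs) = cong₂ _∙_ (f≗g x) (sumMap-cong f≗g xs)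

    sumMap-zero : ∀ xs → sumMap {B} (const ε) xs ≡ ε
    sumMap-zero []       = refl
    sumMap-zero (x ∷ xs) = trans (identityˡ _) (sumMap-zero xs)

    sumMap-∙ : ∀ (f g : B → A) xs → sumMap (λ x → f x ∙ g x) xs ≡ sumMap f xs ∙ sumMap g xs
    sumMap-∙ f g []       = sym (identityˡ ε)
    sumMap-∙ f g (x ∷ xs) = trans (cong (_ ∙_) (sumMap-∙ f g xs)) (interchange _ _ _ _)

    sumMap-homo : (φ : A → A) → (∀ x y → φ (x ∙ y) ≡ φ x ∙ φ y) → φ ε ≡ ε →
                  ∀ (f : B → A) xs → φ (sumMap f xs) ≡ sumMap (φ ∘ f) xs
    sumMap-homo φ φ-∙ φ-ε f []       = φ-ε
    sumMap-homo φ φ-∙ φ-ε f (x ∷ xs) =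
      trans (φ-∙ _ _) (cong (_ ∙_) (sumMap-homo φ φ-∙ φ-ε f xs))

    sumMap-++ : ∀ (f : B → A) xs ys → sumMap f (xs ++ ys) ≡ sumMap f xs ∙ sumMap f ys
    sumMap-++ f []       ys = sym (identityˡ _)
    sumMap-++ f (x ∷ xs) ys = trans (cong (f x ∙_) (sumMap-++ f xs ys)) (sym (assoc _ _ _))

    sumMap-filter : ∀ {P : B → Set} (P? : ∀ x → Dec (P x)) (f : B → A) xs →
                    sumMap f (filter P? xs) ≡ sumMap (λ x → if does (P? x) then f x else ε) xs
    sumMap-filter P? f []       = refl
    sumMap-filter P? f (x ∷ xs) with does (P? x)
    ... | true  = cong (f x ∙_) (sumMap-filter P? f xs)
    ... | false = trans (sumMap-filter P? f xs) (sym (identityˡ _))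

    sumMap-sum : ∀ {m} (F : Fin m → B → A) xs →
                 sumMap (λ x → sum (λ a → F a x)) xs ≡ sum (λ a → sumMap (F a) xs)
    sumMap-sum {m} F []       = sym (sum-replicate-zero m)
    sumMap-sum     F (x ∷ xs) =
      trans (cong (_ ∙_) (sumMap-sum F xs)) (sym (∑-distrib-+ (λ a → F a x) _))

    sumMap-tabulate : ∀ {m} (f : B → A) (g : Fin m → B) → sumMap f (tabulate g) ≡ sum (f ∘ g)
    sumMap-tabulate {zero}  f g = refl
    sumMap-tabulate {suc m} f g = cong (f (g Fin.zero) ∙_) (sumMap-tabulate f (g ∘ Fin.suc))

  sumMap-concatMap : ∀ {B C : Set} (f : C → A) (F : B → List C) xs →
                     sumMap f (concatMap F xs) ≡ sumMap (λ b → sumMap f (F b)) xs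
  sumMap-concatMap f F []       = refl
  sumMap-concatMap f F (b ∷ xs) =
    trans (sumMap-++ f (F b) (concatMap F xs)) (cong (_ ∙_) (sumMap-concatMap f F xs))

  sumMap-map : ∀ {B C : Set} (f : C → A) (g : B → C) xs → sumMap f (map g xs) ≡ sumMap (f ∘ g) xs
  sumMap-map f g xs = cong (foldr _∙_ ε) (sym (List.map-∘ xs))

  sumMap-allWords-suc : ∀ q n (f : Word q (suc n) → A) →
    sumMap f (allWords q (suc n)) ≡ sum (λ a → sumMap (λ y → f (a ∷ y)) (allWords q n))
  sumMap-allWords-suc q n f = begin
    sumMap f (concatMap (λ a → map (a ∷_) (allWords q n)) (List.allFin q))
      ≡⟨ sumMap-concatMap f _ (List.allFin q) ⟩
    sumMap (λ a → sumMap f (map (a ∷_) (allWords q n))) (List.allFin q)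
      ≡⟨ sumMap-cong (λ a → sumMap-map f (a ∷_) (allWords q n)) (List.allFin q) ⟩
    sumMap (λ a → sumMap (λ y → f (a ∷ y)) (allWords q n)) (List.allFin q)
      ≡⟨ sumMap-tabulate {m = q} _ (λ a → a) ⟩
    sum (λ a → sumMap (λ y → f (a ∷ y)) (allWords q n)) ∎

  sumUpTo : ℕ → (ℕ → A) → A
  sumUpTo m h = sum {m} (h ∘ toℕ)

  sumUpTo-cong : ∀ m {h k : ℕ → A} → (∀ t → t < m → h t ≡ k t) → sumUpTo m h ≡ sumUpTo m k
  sumUpTo-cong m h≡k = sum-cong-≗ (λ t → h≡k (toℕ t) (Fin.toℕ<n t))

  sumUpTo-zero : ∀ m {h : ℕ → A} → (∀ t → t < m → h t ≡ ε) → sumUpTo m h ≡ ε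
  sumUpTo-zero m h≡ε = trans (sumUpTo-cong m h≡ε) (sum-replicate-zero m)

  sumUpTo-suc : ∀ m h → sumUpTo (suc m) h ≡ sumUpTo m h ∙ h m
  sumUpTo-suc zero    h = trans (identityʳ _) (sym (identityˡ _))
  sumUpTo-suc (suc m) h = trans (cong (h 0 ∙_) (sumUpTo-suc m (h ∘ suc))) (sym (assoc _ _ _))

  sumUpTo-init : ∀ m h → h m ≡ ε → sumUpTo (suc m) h ≡ sumUpTo m h
  sumUpTo-init m h hm≡ε =
    trans (sumUpTo-suc m h) (trans (cong (sumUpTo m h ∙_) hm≡ε) (identityʳ (sumUpTo m h)))

  sumUpTo-last : ∀ m h → (∀ t → t < m → h t ≡ ε) → sumUpTo (suc m) h ≡ h m
  sumUpTo-last m h init≡ε =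
    trans (sumUpTo-suc m h) (trans (cong (_∙ h m) (sumUpTo-zero m init≡ε)) (identityˡ (h m)))

  sumUpTo-+ : ∀ a m h → sumUpTo (a + m) h ≡ sumUpTo a h ∙ sumUpTo m (λ k → h (a + k))
  sumUpTo-+ zero    m h = sym (identityˡ _)
  sumUpTo-+ (suc a) m h = trans (cong (h 0 ∙_) (sumUpTo-+ a m (h ∘ suc))) (sym (assoc _ _ _))

  sumUpTo-window : ∀ i l r h → (∀ t → t < i → h t ≡ ε) → (∀ k → h (i + (l + k)) ≡ ε) →
                   sumUpTo (i + (l + r)) h ≡ sumUpTo l (λ k → h (i + k))
  sumUpTo-window i l r h below above = begin
    sumUpTo (i + (l + r)) h
      ≡⟨ sumUpTo-+ i (l + r) h ⟩
    sumUpTo i h ∙ sumUpTo (l + r) (λ k → h (i + k))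
      ≡⟨ cong (_∙ sumUpTo (l + r) (λ k → h (i + k))) (sumUpTo-zero i below) ⟩
    ε ∙ sumUpTo (l + r) (λ k → h (i + k))
      ≡⟨ identityˡ _ ⟩
    sumUpTo (l + r) (λ k → h (i + k))
      ≡⟨ sumUpTo-+ l r (λ k → h (i + k)) ⟩
    sumUpTo l (λ k → h (i + k)) ∙ sumUpTo r (λ k → h (i + (l + k)))
      ≡⟨ cong (sumUpTo l (λ k → h (i + k)) ∙_) (sumUpTo-zero r (λ k _ → above k)) ⟩
    sumUpTo l (λ k → h (i + k)) ∙ ε
      ≡⟨ identityʳ _ ⟩
    sumUpTo l (λ k → h (i + k)) ∎

  sumMap-applyUpTo : ∀ (h : ℕ → A) g m → sumMap h (List.applyUpTo g m) ≡ sumUpTo m (h ∘ g)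
  sumMap-applyUpTo h g zero    = refl
  sumMap-applyUpTo h g (suc m) = cong (h (g 0) ∙_) (sumMap-applyUpTo h (g ∘ suc) m)

module ℚΣ = Sums ℚ.+-0-isCommutativeMonoid
module ℕΣ = Sums ℕ.+-0-isCommutativeMonoid

open ℚΣ using (sum; sumMap; sumUpTo)

ℕ-sum-const : ∀ m c → ℕΣ.sum {m} (const c) ≡ m * c
ℕ-sum-const zero    c = refl
ℕ-sum-const (suc m) c = cong (λ s → c + s) (ℕ-sum-const m c)

≤-sum : ∀ {m} (v : Fin m → ℕ) a → v a ≤ ℕΣ.sum v
≤-sum v Fin.zero    = ℕ.m≤m+n (v Fin.zero) _
≤-sum v (Fin.suc a) = ℕ.≤-trans (≤-sum (v ∘ Fin.suc) a) (ℕ.m≤n+m _ (v Fin.zero))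

sumMap-mono : ∀ {B : Set} {g h : B → ℕ} → (∀ x → g x ≤ h x) →
              ∀ xs → ℕΣ.sumMap g xs ≤ ℕΣ.sumMap h xs
sumMap-mono g≤h []       = ℕ.z≤n
sumMap-mono g≤h (x ∷ xs) = ℕ.+-mono-≤ (g≤h x) (sumMap-mono g≤h xs)

length≡sumMap : ∀ {B : Set} (xs : List B) → List.length xs ≡ ℕΣ.sumMap (const 1) xs
length≡sumMap []       = refl
length≡sumMap (x ∷ xs) = cong suc (length≡sumMap xs)

-- eigval writes the (integer) eigenvalues as z / 1.
ι : ℤ → ℚ
ι z = z ℚ./ 1

ι≡mkℚ : ∀ z → ι z ≡ ℚ.mkℚ z 0 (ℕ.sym (ℕ.1-coprimeTo ℤ.∣ z ∣))
ι≡mkℚ z = ℚ.↥p/↧p≡p (ℚ.mkℚ z 0 (ℕ.sym (ℕ.1-coprimeTo ℤ.∣ z ∣)))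

ι-homo-+ : ∀ a b → ι (a ℤ.+ b) ≡ ι a ℚ.+ ι b
ι-homo-+ a b rewrite ι≡mkℚ a | ι≡mkℚ b =
  cong ι (sym (cong₂ ℤ._+_ (ℤ.*-identityʳ a) (ℤ.*-identityʳ b)))

ι-homo‿- : ∀ a → ι (ℤ.- a) ≡ ℚ.- ι a
ι-homo‿- (+ zero)   = refl
ι-homo‿- ℤ.+[1+ n ] = refl
ι-homo‿- ℤ.-[1+ n ] =
  trans (ι≡mkℚ ℤ.+[1+ n ]) (cong ℚ.-_ (cong ℚ.-_ (sym (ι≡mkℚ ℤ.+[1+ n ]))))

ι-homo-- : ∀ a b → ι (a ℤ.- b) ≡ ι a ℚ.- ι b
ι-homo-- a b = trans (ι-homo-+ a (ℤ.- b)) (cong (ι a ℚ.+_) (ι-homo‿- b))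

ι-injective : ∀ {a b} → ι a ≡ ι b → a ≡ b
ι-injective {a} {b} ιa≡ιb =
  cong ℚ.↥_ (trans (sym (ι≡mkℚ a)) (trans ιa≡ιb (ι≡mkℚ b)))

ι-nonZero : ∀ n → ι (+ suc n) ≢ 0ℚ
ι-nonZero n ιn≡0 with ι-injective {+ suc n} {+ 0} ιn≡0
... | ()

x*y≡0⇒y≡0 : ∀ {x y} → x ≢ 0ℚ → x ℚ.* y ≡ 0ℚ → y ≡ 0ℚ
x*y≡0⇒y≡0 {x} {y} x≢0 xy≡0 = begin
  y                       ≡⟨ ℚ.*-identityˡ y ⟨
  ℚ.1ℚ ℚ.* y              ≡⟨ cong (ℚ._* y) (sym (ℚ.*-inverseˡ x)) ⟩
  (ℚ.1/ x) ℚ.* x ℚ.* y    ≡⟨ ℚ.*-assoc (ℚ.1/ x) x y ⟩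
  (ℚ.1/ x) ℚ.* (x ℚ.* y)  ≡⟨ cong ((ℚ.1/ x) ℚ.*_) xy≡0 ⟩
  (ℚ.1/ x) ℚ.* 0ℚ         ≡⟨ ℚ.*-zeroʳ (ℚ.1/ x) ⟩
  0ℚ                      ∎
  where
    open ≡-Reasoning
    instance
      x-nonZero : ℚ.NonZero x
      x-nonZero = ℚ.≢-nonZero x≢0

neg-nonZero : ∀ {x} → x ≢ 0ℚ → ℚ.- x ≢ 0ℚ
neg-nonZero x≢0 -x≡0 = x≢0 (ℚ.neg-injective {q = 0ℚ} -x≡0)

0-0≡0 : ∀ {x y} → x ≡ 0ℚ → y ≡ 0ℚ → x ℚ.- y ≡ 0ℚ
0-0≡0 refl refl = refl

x-y≡0⇒x≡y : ∀ {x y} → x ℚ.- y ≡ 0ℚ → x ≡ y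
x-y≡0⇒x≡y = GroupProperties.x∙y⁻¹≈ε⇒x≈y ℚ.+-0-group _ _

+-cancelʳ-≡ : ∀ c {x y} → x ℚ.+ c ≡ y ℚ.+ c → x ≡ y
+-cancelʳ-≡ c = GroupProperties.∙-cancelʳ ℚ.+-0-group c _ _

sumMap-scale : ∀ {B : Set} c (f : B → ℚ) xs → sumMap (λ x → c ℚ.* f x) xs ≡ c ℚ.* sumMap f xs
sumMap-scale c f xs = sym (ℚΣ.sumMap-homo (c ℚ.*_) (ℚ.*-distribˡ-+ c) (ℚ.*-zeroʳ c) f xs)

sumMap-sub : ∀ {B : Set} (f g : B → ℚ) xs →
             sumMap (λ x → f x ℚ.- g x) xs ≡ sumMap f xs ℚ.- sumMap g xs
sumMap-sub f g xs = trans (ℚΣ.sumMap-∙ f (ℚ.-_ ∘ g) xs)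
  (cong (sumMap f xs ℚ.+_) (sym (ℚΣ.sumMap-homo ℚ.-_ ℚ.neg-distrib-+ refl g xs)))

sum-scale : ∀ {m} c (v : Fin m → ℚ) → sum (λ a → c ℚ.* v a) ≡ c ℚ.* sum v
sum-scale c v = sym (ℚΣ.sum-homo (c ℚ.*_) (ℚ.*-distribˡ-+ c) (ℚ.*-zeroʳ c) v)

sum-sub : ∀ {m} (v w : Fin m → ℚ) → sum (λ a → v a ℚ.- w a) ≡ sum v ℚ.- sum w
sum-sub v w = trans (ℚΣ.∑-distrib-+ v (ℚ.-_ ∘ w))
  (cong (sum v ℚ.+_) (sym (ℚΣ.sum-homo ℚ.-_ ℚ.neg-distrib-+ refl w)))

sum-const : ∀ m c → sum {m} (const c) ≡ ι (+ m) ℚ.* c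
sum-const zero    c = sym (ℚ.*-zeroˡ c)
sum-const (suc m) c = begin
  c ℚ.+ sum {m} (const c)          ≡⟨ cong (c ℚ.+_) (sum-const m c) ⟩
  c ℚ.+ ι (+ m) ℚ.* c              ≡⟨ distrib c (ι (+ m)) ⟩
  (ℚ.1ℚ ℚ.+ ι (+ m)) ℚ.* c         ≡⟨ cong (ℚ._* c) (ι-homo-+ (+ 1) (+ m)) ⟨
  ι (+ suc m) ℚ.* c                ∎
  where
    open ≡-Reasoning
    distrib : ∀ c x → c ℚ.+ x ℚ.* c ≡ (ℚ.1ℚ ℚ.+ x) ℚ.* c
    distrib = solve 2 (λ c x → c :+ x :* c := (con ℚ.1ℚ :+ x) :* c) refl

-- Slices and eigenfunctions of H(n,q)

module Hamming (p : ℕ) where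

  q : ℕ
  q = suc p

  Fun : ℕ → Set
  Fun n = Word q n → ℚ

  slice : ∀ {n} → Fun (suc n) → Fin q → Fun n
  slice f a y = f (a ∷ y)

  sliceSum : ∀ {n} → Fun (suc n) → Fun n
  sliceSum f y = sum (λ a → f (a ∷ y))

  sliceDiff : ∀ {n} → Fun (suc n) → Fin q → Fin q → Fun n
  sliceDiff f a b y = f (a ∷ y) ℚ.- f (b ∷ y)

  hamming-∷-≡ : ∀ {n} a (y z : Word q n) → hamming (a ∷ y) (a ∷ z) ≡ hamming y z
  hamming-∷-≡ a y z with a Fin.≟ a
  ... | yes _  = refl
  ... | no a≢a = ⊥-elim (a≢a refl)

  hamming-∷-≢ : ∀ {n} {a b} (y z : Word q n) → a ≢ b →
                hamming (a ∷ y) (b ∷ z) ≡ suc (hamming y z)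
  hamming-∷-≢ {a = a} {b} y z a≢b with a Fin.≟ b
  ... | yes a≡b = ⊥-elim (a≢b a≡b)
  ... | no _    = refl

  -- Stated with ≡ᵇ because does (suc d ℕ.≟ 1), which occurs in neighbourSum, computes to
  -- d ℕ.≡ᵇ 0.
  sumMap-hamming≡0 : ∀ {n} (y : Word q n) (φ : Fun n) →
    sumMap (λ z → if hamming y z ℕ.≡ᵇ 0 then φ z else 0ℚ) (allWords q n) ≡ φ y
  sumMap-hamming≡0 []      φ = ℚ.+-identityʳ (φ [])
  sumMap-hamming≡0 {suc n} (a ∷ y) φ = begin
    sumMap (λ z → if hamming (a ∷ y) z ℕ.≡ᵇ 0 then φ z else 0ℚ) (allWords q (suc n))
      ≡⟨ ℚΣ.sumMap-allWords-suc q n _ ⟩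
    sum v
      ≡⟨ ℚΣ.sum-single v a off-a ⟩
    v a
      ≡⟨ ℚΣ.sumMap-cong (λ z → cong (λ d → if d ℕ.≡ᵇ 0 then φ (a ∷ z) else 0ℚ)
                                      (hamming-∷-≡ a y z)) (allWords q n) ⟩
    sumMap (λ z → if hamming y z ℕ.≡ᵇ 0 then φ (a ∷ z) else 0ℚ) (allWords q n)
      ≡⟨ sumMap-hamming≡0 y (slice φ a) ⟩
    φ (a ∷ y) ∎
    where
      open ≡-Reasoning
      v : Fin q → ℚ
      v b = sumMap (λ z → if hamming (a ∷ y) (b ∷ z) ℕ.≡ᵇ 0 then φ (b ∷ z) else 0ℚ)
                   (allWords q n)
      off-a : ∀ b → b ≢ a → v b ≡ 0ℚ
      off-a b b≢a = trans
        (ℚΣ.sumMap-cong (λ z → cong (λ d → if d ℕ.≡ᵇ 0 then φ (b ∷ z) else 0ℚ)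
                                    (hamming-∷-≢ y z (b≢a ∘ sym))) (allWords q n))
        (ℚΣ.sumMap-zero (allWords q n))

  neighbourSum-∷ : ∀ {n} (f : Fun (suc n)) a y →
    neighbourSum f (a ∷ y) ≡ (sliceSum f y ℚ.- f (a ∷ y)) ℚ.+ neighbourSum (slice f a) y
  neighbourSum-∷ {n} f a y = begin
    neighbourSum f (a ∷ y)
      ≡⟨ ℚΣ.sumMap-filter (λ z → hamming (a ∷ y) z ℕ.≟ 1) f (allWords q (suc n)) ⟩
    sumMap (λ z → if does (hamming (a ∷ y) z ℕ.≟ 1) then f z else 0ℚ) (allWords q (suc n))
      ≡⟨ ℚΣ.sumMap-allWords-suc q n _ ⟩
    sum v
      ≡⟨ move {s = sliceSum f y} (ℚΣ.sum-swap-at v (λ b → f (b ∷ y)) a off-a) ⟩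
    (sliceSum f y ℚ.- f (a ∷ y)) ℚ.+ v a
      ≡⟨ cong ((sliceSum f y ℚ.- f (a ∷ y)) ℚ.+_) at-a ⟩
    (sliceSum f y ℚ.- f (a ∷ y)) ℚ.+ neighbourSum (slice f a) y ∎
    where
      open ≡-Reasoning
      v : Fin q → ℚ
      v b = sumMap (λ z → if does (hamming (a ∷ y) (b ∷ z) ℕ.≟ 1) then f (b ∷ z) else 0ℚ)
                   (allWords q n)
      off-a : ∀ b → b ≢ a → v b ≡ f (b ∷ y)
      off-a b b≢a = trans
        (ℚΣ.sumMap-cong (λ z → cong (λ d → if does (d ℕ.≟ 1) then f (b ∷ z) else 0ℚ)
                                    (hamming-∷-≢ y z (b≢a ∘ sym))) (allWords q n))
        (sumMap-hamming≡0 y (slice f b))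
      at-a : v a ≡ neighbourSum (slice f a) y
      at-a = trans
        (ℚΣ.sumMap-cong (λ z → cong (λ d → if does (d ℕ.≟ 1) then f (a ∷ z) else 0ℚ)
                                    (hamming-∷-≡ a y z)) (allWords q n))
        (sym (ℚΣ.sumMap-filter (λ z → hamming y z ℕ.≟ 1) (slice f a) (allWords q n)))
      move : ∀ {x w s u} → x ℚ.+ w ≡ s ℚ.+ u → x ≡ (s ℚ.- w) ℚ.+ u
      move {x} {w} {s} {u} eq = begin
        x                     ≡⟨ cancel x w ⟩
        (x ℚ.+ w) ℚ.- w       ≡⟨ cong (ℚ._- w) eq ⟩
        (s ℚ.+ u) ℚ.- w       ≡⟨ reorder s u w ⟩
        (s ℚ.- w) ℚ.+ u       ∎
        where
          cancel : ∀ x w → x ≡ (x ℚ.+ w) ℚ.- w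
          cancel = solve 2 (λ x w → x := (x :+ w) :- w) refl
          reorder : ∀ s u w → (s ℚ.+ u) ℚ.- w ≡ (s ℚ.- w) ℚ.+ u
          reorder = solve 3 (λ s u w → (s :+ u) :- w := (s :- w) :+ u) refl

  neighbours : ∀ {n} → Word q n → List (Word q n)
  neighbours {n} x = filter (λ y → hamming x y ℕ.≟ 1) (allWords q n)

  neighbourSum-cong : ∀ {n} {f g : Fun n} → f ≗ g → ∀ x → neighbourSum f x ≡ neighbourSum g x
  neighbourSum-cong f≗g x = ℚΣ.sumMap-cong f≗g (neighbours x)

  neighbourSum-zero : ∀ {n} {f : Fun n} → f ≗ const 0ℚ → ∀ x → neighbourSum f x ≡ 0ℚ
  neighbourSum-zero f≗0 x = trans (neighbourSum-cong f≗0 x) (ℚΣ.sumMap-zero (neighbours x))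

  neighbourSum-scale : ∀ {n} c (f : Fun n) x →
                       neighbourSum (λ y → c ℚ.* f y) x ≡ c ℚ.* neighbourSum f x
  neighbourSum-scale c f x = sumMap-scale c f (neighbours x)

  neighbourSum-sub : ∀ {n} (f g : Fun n) x →
                     neighbourSum (λ y → f y ℚ.- g y) x ≡ neighbourSum f x ℚ.- neighbourSum g x
  neighbourSum-sub f g x = sumMap-sub f g (neighbours x)

  neighbourSum-sum : ∀ {n m} (F : Fin m → Fun n) x →
                     neighbourSum (λ y → sum (λ a → F a y)) x ≡ sum (λ a → neighbourSum (F a) x)
  neighbourSum-sum F x = ℚΣ.sumMap-sum F (neighbours x)

  module _ {n : ℕ} {μ : ℚ} where

    isEigenfunction-zero : IsEigenfunction {q} {n} μ (const 0ℚ)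
    isEigenfunction-zero x = trans (ℚ.*-zeroʳ μ) (sym (neighbourSum-zero (λ _ → refl) x))

    isEigenfunction-scale : ∀ {f : Fun n} c → IsEigenfunction μ f →
                            IsEigenfunction μ (λ y → c ℚ.* f y)
    isEigenfunction-scale {f} c eig x = begin
      μ ℚ.* (c ℚ.* f x)            ≡⟨ swap μ c (f x) ⟩
      c ℚ.* (μ ℚ.* f x)            ≡⟨ cong (c ℚ.*_) (eig x) ⟩
      c ℚ.* neighbourSum f x       ≡⟨ neighbourSum-scale c f x ⟨
      neighbourSum (λ y → c ℚ.* f y) x ∎
      where
        open ≡-Reasoning
        swap : ∀ a b c → a ℚ.* (b ℚ.* c) ≡ b ℚ.* (a ℚ.* c)
        swap = solve 3 (λ a b c → a :* (b :* c) := b :* (a :* c)) refl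

    isEigenfunction-sub : ∀ {f g : Fun n} → IsEigenfunction μ f → IsEigenfunction μ g →
                          IsEigenfunction μ (λ y → f y ℚ.- g y)
    isEigenfunction-sub {f} {g} eig-f eig-g x = begin
      μ ℚ.* (f x ℚ.- g x)                        ≡⟨ distrib μ (f x) (g x) ⟩
      μ ℚ.* f x ℚ.- μ ℚ.* g x                    ≡⟨ cong₂ ℚ._-_ (eig-f x) (eig-g x) ⟩
      neighbourSum f x ℚ.- neighbourSum g x      ≡⟨ neighbourSum-sub f g x ⟨
      neighbourSum (λ y → f y ℚ.- g y) x         ∎
      where
        open ≡-Reasoning
        distrib : ∀ a b c → a ℚ.* (b ℚ.- c) ≡ a ℚ.* b ℚ.- a ℚ.* c
        distrib = solve 3 (λ a b c → a :* (b :- c) := a :* b :- a :* c) refl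

  module _ {n : ℕ} {μ : ℚ} {f : Fun (suc n)} (eig : IsEigenfunction μ f) where

    neighbourSum-slice : ∀ a y →
      neighbourSum (slice f a) y ≡ (μ ℚ.+ ℚ.1ℚ) ℚ.* f (a ∷ y) ℚ.- sliceSum f y
    neighbourSum-slice a y = begin
      N                                        ≡⟨ cancel N (S ℚ.- x) ⟩
      ((S ℚ.- x) ℚ.+ N) ℚ.- (S ℚ.- x)          ≡⟨ cong (ℚ._- (S ℚ.- x)) (neighbourSum-∷ f a y) ⟨
      neighbourSum f (a ∷ y) ℚ.- (S ℚ.- x)     ≡⟨ cong (ℚ._- (S ℚ.- x)) (eig (a ∷ y)) ⟨
      μ ℚ.* x ℚ.- (S ℚ.- x)                    ≡⟨ collect μ x S ⟩
      (μ ℚ.+ ℚ.1ℚ) ℚ.* x ℚ.- S                 ∎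
      where
        open ≡-Reasoning
        x = f (a ∷ y)
        S = sliceSum f y
        N = neighbourSum (slice f a) y
        cancel : ∀ n s → n ≡ (s ℚ.+ n) ℚ.- s
        cancel = solve 2 (λ n s → n := (s :+ n) :- s) refl
        collect : ∀ c x s → c ℚ.* x ℚ.- (s ℚ.- x) ≡ (c ℚ.+ ℚ.1ℚ) ℚ.* x ℚ.- s
        collect = solve 3 (λ c x s → c :* x :- (s :- x) := (c :+ con ℚ.1ℚ) :* x :- s) refl

    sliceSum-isEigenfunction : IsEigenfunction (μ ℚ.- ι (+ p)) (sliceSum f)
    sliceSum-isEigenfunction y = sym (begin
      neighbourSum (sliceSum f) y
        ≡⟨ neighbourSum-sum (slice f) y ⟩
      sum (λ a → neighbourSum (slice f a) y)
        ≡⟨ ℚΣ.sum-cong-≗ (λ a → neighbourSum-slice a y) ⟩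
      sum (λ a → (μ ℚ.+ ℚ.1ℚ) ℚ.* f (a ∷ y) ℚ.- S)
        ≡⟨ sum-sub (λ a → (μ ℚ.+ ℚ.1ℚ) ℚ.* f (a ∷ y)) (const S) ⟩
      sum (λ a → (μ ℚ.+ ℚ.1ℚ) ℚ.* f (a ∷ y)) ℚ.- sum {q} (const S)
        ≡⟨ cong₂ ℚ._-_ (sum-scale (μ ℚ.+ ℚ.1ℚ) (λ a → f (a ∷ y))) (sum-const q S) ⟩
      (μ ℚ.+ ℚ.1ℚ) ℚ.* S ℚ.- ι (+ q) ℚ.* S
        ≡⟨ cong (λ c → (μ ℚ.+ ℚ.1ℚ) ℚ.* S ℚ.- c ℚ.* S) (ι-homo-+ (+ 1) (+ p)) ⟩
      (μ ℚ.+ ℚ.1ℚ) ℚ.* S ℚ.- (ℚ.1ℚ ℚ.+ ι (+ p)) ℚ.* S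
        ≡⟨ collect μ (ι (+ p)) S ⟩
      (μ ℚ.- ι (+ p)) ℚ.* S ∎)
      where
        open ≡-Reasoning
        S = sliceSum f y
        collect : ∀ m p s → (m ℚ.+ ℚ.1ℚ) ℚ.* s ℚ.- (ℚ.1ℚ ℚ.+ p) ℚ.* s ≡ (m ℚ.- p) ℚ.* s
        collect = solve 3 (λ m p s → (m :+ con ℚ.1ℚ) :* s :- (con ℚ.1ℚ :+ p) :* s
                                      := (m :- p) :* s) refl

    sliceDiff-isEigenfunction : ∀ a b → IsEigenfunction (μ ℚ.+ ℚ.1ℚ) (sliceDiff f a b)
    sliceDiff-isEigenfunction a b y = sym (begin
      neighbourSum (sliceDiff f a b) y
        ≡⟨ neighbourSum-sub (slice f a) (slice f b) y ⟩
      neighbourSum (slice f a) y ℚ.- neighbourSum (slice f b) y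
        ≡⟨ cong₂ ℚ._-_ (neighbourSum-slice a y) (neighbourSum-slice b y) ⟩
      ((μ ℚ.+ ℚ.1ℚ) ℚ.* f (a ∷ y) ℚ.- S) ℚ.- ((μ ℚ.+ ℚ.1ℚ) ℚ.* f (b ∷ y) ℚ.- S)
        ≡⟨ cancel (μ ℚ.+ ℚ.1ℚ) (f (a ∷ y)) (f (b ∷ y)) S ⟩
      (μ ℚ.+ ℚ.1ℚ) ℚ.* sliceDiff f a b y ∎)
      where
        open ≡-Reasoning
        S = sliceSum f y
        cancel : ∀ c x w s → (c ℚ.* x ℚ.- s) ℚ.- (c ℚ.* w ℚ.- s) ≡ c ℚ.* (x ℚ.- w)
        cancel = solve 4 (λ c x w s → (c :* x :- s) :- (c :* w :- s) := c :* (x :- w)) refl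

  eigval-zero : eigval 0 q 0 ≡ 0ℚ
  eigval-zero = cong (λ m → ι (+ 0 ℤ.- + m)) (ℕ.*-zeroʳ q)

  eigval-suc : ∀ n t → eigval (suc n) q t ℚ.- ι (+ p) ≡ eigval n q t
  eigval-suc n t = begin
    ι (+ (suc n * p) ℤ.- + (q * t)) ℚ.- ι (+ p)
      ≡⟨ ι-homo-- (+ (suc n * p) ℤ.- + (q * t)) (+ p) ⟨
    ι ((+ p ℤ.+ + (n * p)) ℤ.- + (q * t) ℤ.- + p)
      ≡⟨ cong ι (cancel (+ p) (+ (n * p)) (+ (q * t))) ⟩
    ι (+ (n * p) ℤ.- + (q * t)) ∎
    where
      open ≡-Reasoning
      cancel : ∀ P A B → (P ℤ.+ A) ℤ.- B ℤ.- P ≡ A ℤ.- B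
      cancel = ℤ.solve-∀

  eigval-suc-suc : ∀ n t → eigval (suc n) q (suc t) ℚ.+ ℚ.1ℚ ≡ eigval n q t
  eigval-suc-suc n t = begin
    ι (+ (suc n * p) ℤ.- + (q * suc t)) ℚ.+ ι (+ 1)
      ≡⟨ ι-homo-+ (+ (suc n * p) ℤ.- + (q * suc t)) (+ 1) ⟨
    ι (+ (suc n * p) ℤ.- + (q * suc t) ℤ.+ + 1)
      ≡⟨ cong (λ m → ι (+ (suc n * p) ℤ.- + m ℤ.+ + 1)) (ℕ.*-suc q t) ⟩
    ι ((+ p ℤ.+ + (n * p)) ℤ.- ((+ 1 ℤ.+ + p) ℤ.+ + (q * t)) ℤ.+ + 1)
      ≡⟨ cong ι (cancel (+ p) (+ (n * p)) (+ (q * t)) (+ 1)) ⟩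
    ι (+ (n * p) ℤ.- + (q * t)) ∎
    where
      open ≡-Reasoning
      cancel : ∀ P A B o → (P ℤ.+ A) ℤ.- ((o ℤ.+ P) ℤ.+ B) ℤ.+ o ≡ A ℤ.- B
      cancel = ℤ.solve-∀

  eigval-injective : ∀ n {t u} → eigval n q t ≡ eigval n q u → t ≡ u
  eigval-injective n {t} {u} eq = ℕ.*-cancelˡ-≡ t u q (ℤ.+-injective (begin
    + (q * t)                                   ≡⟨ cancel (+ (n * p)) (+ (q * t)) ⟩
    + (n * p) ℤ.- (+ (n * p) ℤ.- + (q * t))     ≡⟨ cong (λ z → + (n * p) ℤ.- z)
                                                     (ι-injective {+ (n * p) ℤ.- + (q * t)}
                                                                  {+ (n * p) ℤ.- + (q * u)} eq) ⟩
    + (n * p) ℤ.- (+ (n * p) ℤ.- + (q * u))     ≡⟨ cancel (+ (n * p)) (+ (q * u)) ⟨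
    + (q * u)                                   ∎))
    where
      open ≡-Reasoning
      cancel : ∀ A B → B ≡ A ℤ.- (A ℤ.- B)
      cancel = ℤ.solve-∀

  NotEigenvalue : ℕ → ℚ → Set
  NotEigenvalue n μ = ∀ t → t ≤ n → μ ≢ eigval n q t

  eigenfunction-vanishes : ∀ {n μ} {f : Fun n} → NotEigenvalue n μ → IsEigenfunction μ f →
                           f ≗ const 0ℚ
  eigenfunction-vanishes {zero} {μ} {f} μ∉spec eig [] = x*y≡0⇒y≡0 μ≢0 (eig [])
    where
      μ≢0 : μ ≢ 0ℚ
      μ≢0 μ≡0 = μ∉spec 0 ℕ.z≤n (trans μ≡0 (sym eigval-zero))
  -- S and all Dₐᵦ have eigenvalues outside the spectrum of H(n,q), so all slices of f agree
  -- and sum to zero.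
  eigenfunction-vanishes {suc n} {μ} {f} μ∉spec eig (a ∷ y) = x*y≡0⇒y≡0 (ι-nonZero p) (begin
    ι (+ q) ℚ.* f (a ∷ y)        ≡⟨ sum-const q (f (a ∷ y)) ⟨
    sum {q} (const (f (a ∷ y)))  ≡⟨ ℚΣ.sum-cong-≗ (λ b → x-y≡0⇒x≡y {f (a ∷ y)}
                                                           (diff-vanishes b y)) ⟩
    sliceSum f y                 ≡⟨ sum-vanishes y ⟩
    0ℚ                           ∎)
    where
      open ≡-Reasoning
      sum-vanishes : sliceSum f ≗ const 0ℚ
      sum-vanishes = eigenfunction-vanishes {μ = μ ℚ.- ι (+ p)}
        (λ t t≤n μ-p≡λ → μ∉spec t (ℕ.m≤n⇒m≤1+n t≤n)
                            (+-cancelʳ-≡ (ℚ.- ι (+ p)) (trans μ-p≡λ (sym (eigval-suc n t)))))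
        (sliceSum-isEigenfunction {μ = μ} {f} eig)
      diff-vanishes : ∀ b → sliceDiff f a b ≗ const 0ℚ
      diff-vanishes b = eigenfunction-vanishes {μ = μ ℚ.+ ℚ.1ℚ}
        (λ t t≤n μ+1≡λ → μ∉spec (suc t) (ℕ.s≤s t≤n)
                            (+-cancelʳ-≡ ℚ.1ℚ (trans μ+1≡λ (sym (eigval-suc-suc n t)))))
        (sliceDiff-isEigenfunction {μ = μ} {f} eig a b)

  eigenfunction-vanishes-above : ∀ {n t} {g : Fun n} → n < t → InU t g → g ≗ const 0ℚ
  eigenfunction-vanishes-above {n} {t} n<t = eigenfunction-vanishes
    (λ s s≤n λt≡λs → ℕ.≤⇒≯ s≤n (subst (n <_) (eigval-injective n λt≡λs) n<t))

  module _ {n : ℕ} (μ : ℕ → ℚ) where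

    sumUpTo-weighted : ∀ m (G : ℕ → Fun n) → (∀ t → IsEigenfunction (μ t) (G t)) →
      (∀ y → sumUpTo m (λ t → G t y) ≡ 0ℚ) →
      ∀ c y → sumUpTo m (λ t → (μ t ℚ.- c) ℚ.* G t y) ≡ 0ℚ
    sumUpTo-weighted m G eig ΣG≡0 c y = begin
      sumUpTo m (λ t → (μ t ℚ.- c) ℚ.* G t y)
        ≡⟨ ℚΣ.sumUpTo-cong m (λ t _ → distrib (μ t) c (G t y)) ⟩
      sumUpTo m (λ t → μ t ℚ.* G t y ℚ.- c ℚ.* G t y)
        ≡⟨ sum-sub {m} (λ t → μ (toℕ t) ℚ.* G (toℕ t) y) (λ t → c ℚ.* G (toℕ t) y) ⟩
      sumUpTo m (λ t → μ t ℚ.* G t y) ℚ.- sumUpTo m (λ t → c ℚ.* G t y)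
        ≡⟨ cong₂ ℚ._-_ (ℚΣ.sumUpTo-cong m (λ t _ → eig t y))
                       (sum-scale {m} c (λ t → G (toℕ t) y)) ⟩
      sumUpTo m (λ t → neighbourSum (G t) y) ℚ.- c ℚ.* sumUpTo m (λ t → G t y)
        ≡⟨ cong₂ (λ u v → u ℚ.- c ℚ.* v) (neighbourSum-sum {m = m} (G ∘ toℕ) y)
                                            (sym (ΣG≡0 y)) ⟨
      neighbourSum (λ z → sumUpTo m (λ t → G t z)) y ℚ.- c ℚ.* 0ℚ
        ≡⟨ cong₂ (λ u v → u ℚ.- v) (neighbourSum-zero ΣG≡0 y) (ℚ.*-zeroʳ c) ⟩
      0ℚ ∎
      where
        open ≡-Reasoning
        distrib : ∀ a c g → (a ℚ.- c) ℚ.* g ≡ a ℚ.* g ℚ.- c ℚ.* g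
        distrib = solve 3 (λ a c g → (a :- c) :* g := a :* g :- c :* g) refl

    eigenfunctions-independent : (∀ {s t} → μ s ≡ μ t → s ≡ t) →
      ∀ m (G : ℕ → Fun n) → (∀ t → IsEigenfunction (μ t) (G t)) →
      (∀ y → sumUpTo m (λ t → G t y) ≡ 0ℚ) → ∀ t → t < m → G t ≗ const 0ℚ
    -- Applying neighbourSum - μ m kills G m and multiplies G t by μ t - μ m ≢ 0.
    eigenfunctions-independent μ-injective (suc m) G eig ΣG≡0 = vanish
      where
        c : ℕ → ℚ
        c t = μ t ℚ.- μ m
        self-cancel : ∀ x g → (x ℚ.- x) ℚ.* g ≡ 0ℚ
        self-cancel = solve 2 (λ x g → (x :- x) :* g := con 0ℚ) refl
        weighted-init : ∀ y → sumUpTo m (λ t → c t ℚ.* G t y) ≡ 0ℚ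
        weighted-init y = trans
          (sym (ℚΣ.sumUpTo-init m (λ t → c t ℚ.* G t y) (self-cancel (μ m) (G m y))))
          (sumUpTo-weighted (suc m) G eig ΣG≡0 (μ m) y)
        below : ∀ t → t < m → G t ≗ const 0ℚ
        below t t<m y = x*y≡0⇒y≡0 ct≢0 (eigenfunctions-independent μ-injective m
          (λ t y → c t ℚ.* G t y) (λ t → isEigenfunction-scale {μ = μ t} (c t) (eig t))
          weighted-init t t<m y)
          where
            ct≢0 : c t ≢ 0ℚ
            ct≢0 ct≡0 = ℕ.<⇒≢ t<m (μ-injective (x-y≡0⇒x≡y ct≡0))
        vanish : ∀ t → t < suc m → G t ≗ const 0ℚ
        vanish t t<1+m y with ℕ.m≤n⇒m<n∨m≡n (ℕ.s≤s⁻¹ t<1+m)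
        ... | inj₁ t<m  = below t t<m y
        ... | inj₂ refl = trans (sym (ℚΣ.sumUpTo-last m (λ t → G t y) (λ t t<m → below t t<m y)))
                                (ΣG≡0 y)

  -- Spectral decompositions

  -- A witness of f ∈ U_[i,j](n,q), normalised to one component for every t ≤ n.
  record Decomposition {n} (i j : ℕ) (f : Fun n) : Set where
    field
      component       : ℕ → Fun n
      component-eigen : ∀ t → InU t (component t)
      vanishes-below  : ∀ t → t < i → component t ≗ const 0ℚ
      vanishes-above  : ∀ t → j < t → component t ≗ const 0ℚ
      sums-to         : ∀ y → f y ≡ sumUpTo (suc n) (λ t → component t y)

  open Decomposition

  module _ {n : ℕ} {i j : ℕ} where

    decomposition-cong : ∀ {f g : Fun n} → f ≗ g → Decomposition i j f → Decomposition i j g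
    decomposition-cong f≗g d = record
      { component       = component d
      ; component-eigen = component-eigen d
      ; vanishes-below  = vanishes-below d
      ; vanishes-above  = vanishes-above d
      ; sums-to         = λ y → trans (sym (f≗g y)) (sums-to d y)
      }

    decomposition-widen : ∀ {i′ j′} {f : Fun n} → i′ ≤ i → j ≤ j′ →
                          Decomposition i j f → Decomposition i′ j′ f
    decomposition-widen i′≤i j≤j′ d = record
      { component       = component d
      ; component-eigen = component-eigen d
      ; vanishes-below  = λ t t<i′ → vanishes-below d t (ℕ.<-≤-trans t<i′ i′≤i)
      ; vanishes-above  = λ t j′<t → vanishes-above d t (ℕ.≤-<-trans j≤j′ j′<t)
      ; sums-to         = sums-to d
      }

    decomposition-top : ∀ {f : Fun n} → Decomposition i j f → Decomposition i n f
    decomposition-top d = record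
      { component       = component d
      ; component-eigen = component-eigen d
      ; vanishes-below  = vanishes-below d
      ; vanishes-above  = λ t n<t → eigenfunction-vanishes-above n<t (component-eigen d t)
      ; sums-to         = sums-to d
      }

    decomposition-empty : ∀ {f : Fun n} → j < i → Decomposition i j f → f ≗ const 0ℚ
    decomposition-empty j<i d y =
      trans (sums-to d y) (ℚΣ.sumUpTo-zero (suc n) (λ t _ → vanishes t y))
      where
        vanishes : ∀ t → component d t ≗ const 0ℚ
        vanishes t with t ℕ.<? i
        ... | yes t<i = vanishes-below d t t<i
        ... | no  t≮i = vanishes-above d t (ℕ.<-≤-trans j<i (ℕ.≮⇒≥ t≮i))

    decomposition-sub : ∀ {f g : Fun n} → Decomposition i j f → Decomposition i j g →
                        Decomposition i j (λ y → f y ℚ.- g y)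
    decomposition-sub d e = record
      { component       = λ t y → component d t y ℚ.- component e t y
      ; component-eigen = λ t → isEigenfunction-sub {μ = eigval n q t} {component d t}
                                  (component-eigen d t) (component-eigen e t)
      ; vanishes-below  = λ t t<i y → 0-0≡0 (vanishes-below d t t<i y) (vanishes-below e t t<i y)
      ; vanishes-above  = λ t j<t y → 0-0≡0 (vanishes-above d t j<t y) (vanishes-above e t j<t y)
      ; sums-to         = λ y → trans (cong₂ ℚ._-_ (sums-to d y) (sums-to e y))
          (sym (sum-sub {suc n} (λ t → component d (toℕ t) y) (λ t → component e (toℕ t) y)))
      }

  module _ {n i j : ℕ} {f : Fun (suc n)} (d : Decomposition i j f) where

    private
      sliceSum-eigen : ∀ t → InU t (sliceSum (component d t))
      sliceSum-eigen t = subst (λ μ → IsEigenfunction μ (sliceSum (component d t))) (eigval-suc n t)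
        (sliceSum-isEigenfunction {μ = eigval (suc n) q t} {component d t} (component-eigen d t))

      sliceDiff-eigen : ∀ t a b → InU t (sliceDiff (component d (suc t)) a b)
      sliceDiff-eigen t a b =
        subst (λ μ → IsEigenfunction μ (sliceDiff (component d (suc t)) a b)) (eigval-suc-suc n t)
          (sliceDiff-isEigenfunction {μ = eigval (suc n) q (suc t)} {component d (suc t)}
            (component-eigen d (suc t)) a b)

      -- Its eigenvalue λ₀(n+1) + 1 = n(q-1) + q lies above the spectrum of H(n,q).
      sliceDiff-component₀ : ∀ a b → sliceDiff (component d 0) a b ≗ const 0ℚ
      sliceDiff-component₀ a b = eigenfunction-vanishes {μ = eigval (suc n) q 0 ℚ.+ ℚ.1ℚ}
        (λ t _ λ₀+1≡λ → ℕ.0≢1+n (eigval-injective (suc n)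
          (+-cancelʳ-≡ ℚ.1ℚ (trans λ₀+1≡λ (sym (eigval-suc-suc n t))))))
        (sliceDiff-isEigenfunction {μ = eigval (suc n) q 0} {component d 0} (component-eigen d 0) a b)

    decomposition-sliceSum : Decomposition i j (sliceSum f)
    decomposition-sliceSum = record
      { component       = λ t → sliceSum (component d t)
      ; component-eigen = sliceSum-eigen
      ; vanishes-below  = λ t t<i y → ℚΣ.sum-zero (λ a → vanishes-below d t t<i (a ∷ y))
      ; vanishes-above  = λ t j<t y → ℚΣ.sum-zero (λ a → vanishes-above d t j<t (a ∷ y))
      ; sums-to         = sums
      }
      where
        open ≡-Reasoning
        Σ′ : Fun n
        Σ′ y = sumUpTo (suc n) (λ t → sliceSum (component d t) y)
        sums : ∀ y → sliceSum f y ≡ Σ′ y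
        sums y = begin
          sum (λ a → f (a ∷ y))
            ≡⟨ ℚΣ.sum-cong-≗ (λ a → sums-to d (a ∷ y)) ⟩
          sum (λ a → sumUpTo (suc (suc n)) (λ t → component d t (a ∷ y)))
            ≡⟨ ℚΣ.∑-comm (λ a (t : Fin (suc (suc n))) → component d (toℕ t) (a ∷ y)) ⟩
          sumUpTo (suc (suc n)) (λ t → sliceSum (component d t) y)
            ≡⟨ ℚΣ.sumUpTo-init (suc n) (λ t → sliceSum (component d t) y)
                 (eigenfunction-vanishes-above (ℕ.n<1+n n) (sliceSum-eigen (suc n)) y) ⟩
          Σ′ y ∎

    sliceDiff-sums-to : ∀ a b y →
      sliceDiff f a b y ≡ sumUpTo (suc n) (λ t → sliceDiff (component d (suc t)) a b y)
    sliceDiff-sums-to a b y = begin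
      f (a ∷ y) ℚ.- f (b ∷ y)
        ≡⟨ cong₂ ℚ._-_ (sums-to d (a ∷ y)) (sums-to d (b ∷ y)) ⟩
      sumUpTo (suc (suc n)) (λ t → component d t (a ∷ y))
        ℚ.- sumUpTo (suc (suc n)) (λ t → component d t (b ∷ y))
        ≡⟨ sum-sub {suc (suc n)} (λ t → component d (toℕ t) (a ∷ y))
                                 (λ t → component d (toℕ t) (b ∷ y)) ⟨
      sliceDiff (component d 0) a b y ℚ.+ Σ′
        ≡⟨ cong (ℚ._+ Σ′) (sliceDiff-component₀ a b y) ⟩
      0ℚ ℚ.+ Σ′
        ≡⟨ ℚ.+-identityˡ Σ′ ⟩
      Σ′ ∎
      where
        open ≡-Reasoning
        Σ′ = sumUpTo (suc n) (λ t → sliceDiff (component d (suc t)) a b y)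

    decomposition-sliceDiff : ∀ a b → Decomposition (ℕ.pred i) (ℕ.pred j) (sliceDiff f a b)
    decomposition-sliceDiff a b = record
      { component       = λ t → sliceDiff (component d (suc t)) a b
      ; component-eigen = λ t → sliceDiff-eigen t a b
      ; vanishes-below  = λ t t<i y → let below = vanishes-below d (suc t) (ℕ.pred-cancel-< t<i) in
                                      0-0≡0 (below (a ∷ y)) (below (b ∷ y))
      ; vanishes-above  = λ t j<t y → let above = vanishes-above d (suc t) (ℕ.pred-cancel-< j<t) in
                                      0-0≡0 (above (a ∷ y)) (above (b ∷ y))
      ; sums-to         = sliceDiff-sums-to a b
      }

    sliceDiff-vanishes : j ≡ 0 → ∀ a b → sliceDiff f a b ≗ const 0ℚ
    sliceDiff-vanishes j≡0 a b y = trans (sliceDiff-sums-to a b y) (ℚΣ.sumUpTo-zero (suc n) vanish)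
      where
        vanish : ∀ t → t < suc n → sliceDiff (component d (suc t)) a b y ≡ 0ℚ
        vanish t _ =
          let above = vanishes-above d (suc t) (subst (_< suc t) (sym j≡0) (ℕ.s≤s ℕ.z≤n)) in
          0-0≡0 (above (a ∷ y)) (above (b ∷ y))

  decomposition-inter : ∀ {n i j i′ j′} {f : Fun n} →
    Decomposition i j f → Decomposition i′ j′ f → Decomposition i j′ f
  decomposition-inter {n} {j′ = j′} {f} d e = record
    { component       = component d
    ; component-eigen = component-eigen d
    ; vanishes-below  = vanishes-below d
    ; vanishes-above  = above
    ; sums-to         = sums-to d
    }
    where
      difference : ℕ → Fun n
      difference t y = component d t y ℚ.- component e t y
      difference-eigen : ∀ t → InU t (difference t)
      difference-eigen t = isEigenfunction-sub {μ = eigval n q t} {component d t} {component e t}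
                             (component-eigen d t) (component-eigen e t)
      differences-cancel : ∀ y → sumUpTo (suc n) (λ t → difference t y) ≡ 0ℚ
      differences-cancel y = begin
        sumUpTo (suc n) (λ t → difference t y)
          ≡⟨ sum-sub {suc n} (λ t → component d (toℕ t) y) (λ t → component e (toℕ t) y) ⟩
        sumUpTo (suc n) (λ t → component d t y) ℚ.- sumUpTo (suc n) (λ t → component e t y)
          ≡⟨ cong₂ ℚ._-_ (sums-to d y) (sums-to e y) ⟨
        f y ℚ.- f y
          ≡⟨ ℚ.+-inverseʳ (f y) ⟩
        0ℚ ∎
        where open ≡-Reasoning
      above : ∀ t → j′ < t → component d t ≗ const 0ℚ
      above t j′<t y with t ℕ.≤? n
      ... | yes t≤n = trans
        (x-y≡0⇒x≡y (eigenfunctions-independent (eigval n q) (eigval-injective n) (suc n)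
                      difference difference-eigen differences-cancel t (ℕ.s≤s t≤n) y))
        (vanishes-above e t j′<t y)
      ... | no t≰n = eigenfunction-vanishes-above (ℕ.≰⇒> t≰n) (component-eigen d t) y

  keepIf : ∀ {n} {P : Set} → Dec P → Fun n → Fun n
  keepIf (yes _) g = g
  keepIf (no _)  _ = const 0ℚ

  module _ {n : ℕ} (i j : ℕ) (g : ℕ → Fun n) where

    between : ℕ → Fun n
    between t = keepIf (i ℕ.≤? t ×-dec t ℕ.≤? j) (g t)

    between-eigen : (∀ t → i ≤ t → t ≤ j → InU t (g t)) → ∀ t → InU t (between t)
    between-eigen g-eigen t with i ℕ.≤? t ×-dec t ℕ.≤? j
    ... | yes (i≤t , t≤j) = g-eigen t i≤t t≤j
    ... | no _            = isEigenfunction-zero {μ = eigval n q t}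

    between-below : ∀ t → t < i → between t ≗ const 0ℚ
    between-below t t<i with i ℕ.≤? t ×-dec t ℕ.≤? j
    ... | yes (i≤t , _) = ⊥-elim (ℕ.<⇒≱ t<i i≤t)
    ... | no _          = λ _ → refl

    between-above : ∀ t → j < t → between t ≗ const 0ℚ
    between-above t j<t with i ℕ.≤? t ×-dec t ℕ.≤? j
    ... | yes (_ , t≤j) = ⊥-elim (ℕ.<⇒≱ j<t t≤j)
    ... | no _          = λ _ → refl

    between-inside : ∀ t → i ≤ t → t ≤ j → between t ≗ g t
    between-inside t i≤t t≤j with i ℕ.≤? t ×-dec t ℕ.≤? j
    ... | yes _     = λ _ → refl
    ... | no ¬i≤t≤j = ⊥-elim (¬i≤t≤j (i≤t , t≤j))

  decomposition-from-InUrange : ∀ {n i j} {f : Fun n} → i ≤ j → j ≤ n → InUrange i j f →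
                                Decomposition i j f
  decomposition-from-InUrange {n} {i} {j} {f} i≤j j≤n (g , g-eigen , f≡Σg) = record
    { component       = G
    ; component-eigen = between-eigen i j g g-eigen
    ; vanishes-below  = between-below i j g
    ; vanishes-above  = between-above i j g
    ; sums-to         = sums
    }
    where
      open ≡-Reasoning
      G = between i j g
      l = suc (j ∸ i)
      i+k≤j : ∀ k → k < l → i + k ≤ j
      i+k≤j k k<l =
        ℕ.≤-trans (ℕ.+-monoʳ-≤ i (ℕ.s≤s⁻¹ k<l)) (ℕ.≤-reflexive (ℕ.m+[n∸m]≡n i≤j))
      j<i+[l+k] : ∀ k → j < i + (l + k)
      j<i+[l+k] k = ℕ.≤-trans (ℕ.≤-reflexive (cong suc (sym (ℕ.m+[n∸m]≡n i≤j))))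
                              (ℕ.≤-trans (ℕ.≤-reflexive (sym (ℕ.+-suc i (j ∸ i))))
                                         (ℕ.+-monoʳ-≤ i (ℕ.m≤m+n l k)))
      i+[l+r]≡1+n : i + (l + (n ∸ j)) ≡ suc n
      i+[l+r]≡1+n = begin
        i + suc (j ∸ i + (n ∸ j))   ≡⟨ ℕ.+-suc i (j ∸ i + (n ∸ j)) ⟩
        suc (i + (j ∸ i + (n ∸ j))) ≡⟨ cong suc (ℕ.+-assoc i (j ∸ i) (n ∸ j)) ⟨
        suc (i + (j ∸ i) + (n ∸ j)) ≡⟨ cong (λ m → suc (m + (n ∸ j))) (ℕ.m+[n∸m]≡n i≤j) ⟩
        suc (j + (n ∸ j))           ≡⟨ cong suc (ℕ.m+[n∸m]≡n j≤n) ⟩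
        suc n                       ∎
      sums : ∀ y → f y ≡ sumUpTo (suc n) (λ t → G t y)
      sums y = begin
        f y
          ≡⟨ f≡Σg y ⟩
        sumMap (λ k → g (i + k) y) (List.upTo l)
          ≡⟨ ℚΣ.sumMap-applyUpTo (λ k → g (i + k) y) (λ k → k) l ⟩
        sumUpTo l (λ k → g (i + k) y)
          ≡⟨ ℚΣ.sumUpTo-cong l (λ k k<l →
               between-inside i j g (i + k) (ℕ.m≤m+n i k) (i+k≤j k k<l) y) ⟨
        sumUpTo l (λ k → G (i + k) y)
          ≡⟨ ℚΣ.sumUpTo-window i l (n ∸ j) (λ t → G t y) (λ t t<i → between-below i j g t t<i y)
               (λ k → between-above i j g (i + (l + k)) (j<i+[l+k] k) y) ⟨
        sumUpTo (i + (l + (n ∸ j))) (λ t → G t y)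
          ≡⟨ cong (λ m → sumUpTo m (λ t → G t y)) i+[l+r]≡1+n ⟩
        sumUpTo (suc n) (λ t → G t y) ∎

  -- Supports and uniformity

  -- Stated with not and does so that it is literally the test used by filter in support.
  isNonzero : ℚ → ℕ
  isNonzero x = if not (does (x ℚ.≟ 0ℚ)) then 1 else 0

  isNonzero-0 : ∀ {x} → x ≡ 0ℚ → isNonzero x ≡ 0
  isNonzero-0 refl = refl

  isNonzero≤1 : ∀ x → isNonzero x ≤ 1
  isNonzero≤1 x with x ℚ.≟ 0ℚ
  ... | yes _ = ℕ.z≤n
  ... | no _  = ℕ.≤-refl

  isNonzero-subadditive : ∀ {x y z} → (y ≡ 0ℚ → z ≡ 0ℚ → x ≡ 0ℚ) →
                          isNonzero x ≤ isNonzero y + isNonzero z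
  isNonzero-subadditive {x} {y} {z} zeros with y ℚ.≟ 0ℚ | z ℚ.≟ 0ℚ
  ... | yes y≡0 | yes z≡0 = ℕ.≤-reflexive (isNonzero-0 (zeros y≡0 z≡0))
  ... | yes _   | no _    = isNonzero≤1 x
  ... | no _    | _       = ℕ.≤-trans (isNonzero≤1 x) (ℕ.m≤m+n 1 _)

  module _ {n : ℕ} where

    support≡sumMap : ∀ (f : Fun n) → support f ≡ ℕΣ.sumMap (isNonzero ∘ f) (allWords q n)
    support≡sumMap f = trans (length≡sumMap (filter (λ x → ¬? (f x ℚ.≟ 0ℚ)) (allWords q n)))
      (ℕΣ.sumMap-filter (λ x → ¬? (f x ℚ.≟ 0ℚ)) (const 1) (allWords q n))

    support-subadditive : ∀ (f g h : Fun n) → (∀ y → g y ≡ 0ℚ → h y ≡ 0ℚ → f y ≡ 0ℚ) →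
                          support f ≤ support g + support h
    support-subadditive f g h zeros = begin
      support f
        ≡⟨ support≡sumMap f ⟩
      ℕΣ.sumMap (isNonzero ∘ f) W
        ≤⟨ sumMap-mono (λ y → isNonzero-subadditive (zeros y)) W ⟩
      ℕΣ.sumMap (λ y → isNonzero (g y) + isNonzero (h y)) W
        ≡⟨ ℕΣ.sumMap-∙ (isNonzero ∘ g) (isNonzero ∘ h) W ⟩
      ℕΣ.sumMap (isNonzero ∘ g) W + ℕΣ.sumMap (isNonzero ∘ h) W
        ≡⟨ cong₂ _+_ (support≡sumMap g) (support≡sumMap h) ⟨
      support g + support h ∎
      where
        open ℕ.≤-Reasoning
        W = allWords q n

    support-zero : ∀ {f : Fun n} → f ≗ const 0ℚ → support f ≡ 0
    support-zero {f} f≡0 = trans (support≡sumMap f)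
      (trans (ℕΣ.sumMap-cong (isNonzero-0 ∘ f≡0) (allWords q n)) (ℕΣ.sumMap-zero (allWords q n)))

    support-mono : ∀ (f g : Fun n) → (∀ y → g y ≡ 0ℚ → f y ≡ 0ℚ) → support f ≤ support g
    support-mono f g zeros = begin
      support f
        ≤⟨ support-subadditive f g (const 0ℚ) (λ y g≡0 _ → zeros y g≡0) ⟩
      support g + support {q} {n} (const 0ℚ)
        ≡⟨ cong (λ s → support g + s) (support-zero {const 0ℚ} (λ _ → refl)) ⟩
      support g + 0
        ≡⟨ ℕ.+-identityʳ (support g) ⟩
      support g ∎
      where open ℕ.≤-Reasoning

    support-cong : ∀ (f g : Fun n) → (∀ y → f y ≡ 0ℚ → g y ≡ 0ℚ) →
                   (∀ y → g y ≡ 0ℚ → f y ≡ 0ℚ) → support f ≡ support g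
    support-cong f g f→g g→f = ℕ.≤-antisym (support-mono f g g→f) (support-mono g f f→g)

    support-scale : ∀ {c} (f g : Fun n) → c ≢ 0ℚ → (∀ y → f y ≡ c ℚ.* g y) →
                    support f ≡ support g
    support-scale {c} f g c≢0 f≡cg = support-cong f g
      (λ y f≡0 → x*y≡0⇒y≡0 c≢0 (trans (sym (f≡cg y)) f≡0))
      (λ y g≡0 → trans (f≡cg y) (trans (cong (c ℚ.*_) g≡0) (ℚ.*-zeroʳ c)))

  support-cong-≗ : ∀ {n} {f g : Fun n} → f ≗ g → support f ≡ support g
  support-cong-≗ {f = f} {g} f≗g =
    support-cong f g (λ y f≡0 → trans (sym (f≗g y)) f≡0) (λ y g≡0 → trans (f≗g y) g≡0)

  support-∷ : ∀ {n} (f : Fun (suc n)) → support f ≡ ℕΣ.sum (λ a → support (slice f a))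
  support-∷ {n} f = begin
    support f
      ≡⟨ support≡sumMap f ⟩
    ℕΣ.sumMap (isNonzero ∘ f) (allWords q (suc n))
      ≡⟨ ℕΣ.sumMap-allWords-suc q n (isNonzero ∘ f) ⟩
    ℕΣ.sum (λ a → ℕΣ.sumMap (isNonzero ∘ slice f a) (allWords q n))
      ≡⟨ ℕΣ.sum-cong-≗ (λ a → support≡sumMap (slice f a)) ⟨
    ℕΣ.sum (λ a → support (slice f a)) ∎
    where open ≡-Reasoning

  isNonzero≡0⇒≡0 : ∀ {x} → isNonzero x ≡ 0 → x ≡ 0ℚ
  isNonzero≡0⇒≡0 {x} nz≡0 with x ℚ.≟ 0ℚ
  ... | yes x≡0 = x≡0
  ... | no _    = ⊥-elim (ℕ.1+n≢0 nz≡0)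

  support≡0⇒vanishes : ∀ {n} (f : Fun n) → support f ≡ 0 → f ≗ const 0ℚ
  support≡0⇒vanishes {zero}  f |f|≡0 [] =
    isNonzero≡0⇒≡0 (trans (sym (ℕ.+-identityʳ _)) (trans (sym (support≡sumMap f)) |f|≡0))
  support≡0⇒vanishes {suc n} f |f|≡0 (a ∷ y) = support≡0⇒vanishes (slice f a) |fₐ|≡0 y
    where
      |fₐ|≡0 : support (slice f a) ≡ 0
      |fₐ|≡0 = ℕ.n≤0⇒n≡0 (ℕ.≤-trans (≤-sum (λ b → support (slice f b)) a)
                                    (ℕ.≤-reflexive (trans (sym (support-∷ f)) |f|≡0)))

  uniform-sliceMap : ∀ {n} (f : Fun (suc n)) (φ : (Fin q → ℚ) → ℚ) →
                     (∀ {u v} → u ≗ v → φ u ≡ φ v) →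
                     Uniform f → Uniform (λ y → φ (λ a → f (a ∷ y)))
  uniform-sliceMap {zero}  f φ φ-cong uniform   = tt
  uniform-sliceMap {suc n} f φ φ-cong uniform r =
    proj₁ (uniform (Fin.suc r)) ,
    λ k m k≢l m≢l y → φ-cong (λ a → proj₂ (uniform (Fin.suc r)) k m k≢l m≢l (a ∷ y))

-- The support bound

suc∸≡∸pred : ∀ n {j} → j ≢ 0 → suc n ∸ j ≡ n ∸ ℕ.pred j
suc∸≡∸pred n {zero}  j≢0 = ⊥-elim (j≢0 refl)
suc∸≡∸pred n {suc j} _   = refl

^≤*^pred : ∀ m i .{{_ : ℕ.NonZero m}} → m ^ i ≤ m * m ^ ℕ.pred i
^≤*^pred m zero    = ℕ.m≤n*m 1 m
^≤*^pred m (suc i) = ℕ.≤-refl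

scaled-bound : ∀ {b m s} a i .{{_ : ℕ.NonZero m}} →
  b ^ a * m ^ ℕ.pred i ≤ m ^ a * s → b ^ a * m ^ i ≤ m ^ a * (m * s)
scaled-bound {b} {m} {s} a i bound = begin
  b ^ a * m ^ i                  ≤⟨ ℕ.*-monoʳ-≤ (b ^ a) (^≤*^pred m i) ⟩
  b ^ a * (m * m ^ ℕ.pred i)     ≡⟨ swap (b ^ a) m (m ^ ℕ.pred i) ⟩
  m * (b ^ a * m ^ ℕ.pred i)     ≤⟨ ℕ.*-monoʳ-≤ m bound ⟩
  m * (m ^ a * s)                ≡⟨ swap m (m ^ a) s ⟩
  m ^ a * (m * s)                ∎
  where
    open ℕ.≤-Reasoning
    swap : ∀ x y z → x * (y * z) ≡ y * (x * z)
    swap = ℕ.solve-∀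

combined-bound : ∀ r a i {sS sg sh} →
  (2 * suc r) ^ a * (2 + r) ^ i ≤ (2 + r) ^ a * sS →
  (2 * suc r) ^ a * (2 + r) ^ ℕ.pred i ≤ (2 + r) ^ a * sg →
  sS ≤ sg + sh →
  (2 * suc r) ^ suc a * (2 + r) ^ i ≤ (2 + r) ^ suc a * (sh + suc r * sg)
-- Here q = 2 + r, and 2(q-1) = q + r splits the left-hand side between the two bounds.
combined-bound r a i {sS} {sg} {sh} boundS boundg sS≤sg+sh = begin
  (2 * suc r) ^ suc a * (2 + r) ^ i    ≡⟨ split r ((2 * suc r) ^ a) ((2 + r) ^ i) ⟩
  q * X + r * X
    ≤⟨ ℕ.+-mono-≤ (ℕ.*-monoʳ-≤ q boundS) (ℕ.*-monoʳ-≤ r X≤qY) ⟩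
  q * (qᵃ * sS) + r * (q * Y)
    ≤⟨ ℕ.+-monoʳ-≤ (q * (qᵃ * sS)) (ℕ.*-monoʳ-≤ r (ℕ.*-monoʳ-≤ q boundg)) ⟩
  q * (qᵃ * sS) + r * (q * (qᵃ * sg))   ≡⟨ collect r qᵃ sS sg ⟩
  q * qᵃ * (sS + r * sg)
    ≤⟨ ℕ.*-monoʳ-≤ (q * qᵃ) (ℕ.+-monoˡ-≤ (r * sg) sS≤sg+sh) ⟩
  q * qᵃ * (sg + sh + r * sg)           ≡⟨ cong (q * qᵃ *_) (regroup r sg sh) ⟩
  q ^ suc a * (sh + suc r * sg)         ∎
  where
    open ℕ.≤-Reasoning
    q = 2 + r
    qᵃ = q ^ a
    X = (2 * suc r) ^ a * q ^ i
    Y = (2 * suc r) ^ a * q ^ ℕ.pred i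
    X≤qY : X ≤ q * Y
    X≤qY = ℕ.≤-trans (ℕ.*-monoʳ-≤ ((2 * suc r) ^ a) (^≤*^pred q i))
                     (ℕ.≤-reflexive (swap ((2 * suc r) ^ a) q (q ^ ℕ.pred i)))
      where
        swap : ∀ x y z → x * (y * z) ≡ y * (x * z)
        swap = ℕ.solve-∀
    split : ∀ r A B → (2 * suc r) * A * B ≡ (2 + r) * (A * B) + r * (A * B)
    split = ℕ.solve-∀
    collect : ∀ r Qa sS sg →
              (2 + r) * (Qa * sS) + r * ((2 + r) * (Qa * sg)) ≡ (2 + r) * Qa * (sS + r * sg)
    collect = ℕ.solve-∀
    regroup : ∀ r sg sh → sg + sh + r * sg ≡ sh + suc r * sg
    regroup = ℕ.solve-∀

^-distribʳ-* : ∀ x y a → (x * y) ^ a ≡ x ^ a * y ^ a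
^-distribʳ-* x y zero    = refl
^-distribʳ-* x y (suc a) =
  trans (cong (x * y *_) (^-distribʳ-* x y a)) (interchange x y (x ^ a) (y ^ a))
  where
    interchange : ∀ x y u v → x * y * (u * v) ≡ x * u * (y * v)
    interchange = ℕ.solve-∀

^-rearrange : ∀ x y m a c → m ^ a * (x ^ a * y ^ a * m ^ c) ≡ (x * y) ^ a * m ^ (a + c)
^-rearrange x y m a c = begin
  m ^ a * (x ^ a * y ^ a * m ^ c)    ≡⟨ swap (m ^ a) (x ^ a * y ^ a) (m ^ c) ⟩
  x ^ a * y ^ a * (m ^ a * m ^ c)    ≡⟨ cong₂ _*_ (^-distribʳ-* x y a) (ℕ.^-distribˡ-+-* m a c) ⟨
  (x * y) ^ a * m ^ (a + c)          ∎
  where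
    open ≡-Reasoning
    swap : ∀ u v w → u * (v * w) ≡ v * (u * w)
    swap = ℕ.solve-∀

∸-+-∸ : ∀ {i j n} → j ≤ n → n ≤ i + j → n ∸ j + (i + j ∸ n) ≡ i
∸-+-∸ {i} {j} {n} j≤n n≤i+j = ℕ.+-cancelˡ-≡ j _ i (begin
  j + (n ∸ j + (i + j ∸ n))   ≡⟨ ℕ.+-assoc j (n ∸ j) (i + j ∸ n) ⟨
  j + (n ∸ j) + (i + j ∸ n)   ≡⟨ cong (_+ (i + j ∸ n)) (ℕ.m+[n∸m]≡n j≤n) ⟩
  n + (i + j ∸ n)             ≡⟨ ℕ.m+[n∸m]≡n n≤i+j ⟩
  i + j                       ≡⟨ ℕ.+-comm i j ⟩
  j + i                       ∎)
  where open ≡-Reasoning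

module SupportBound (r : ℕ) where

  p : ℕ
  p = suc r

  open Hamming p
  open Decomposition

  Bounded : ℕ → ℕ → ℕ → Set
  Bounded i a s = (2 * p) ^ a * q ^ i ≤ q ^ a * s

  Bound : ℕ → Set
  Bound n = ∀ i j (f : Fun n) → j ≤ n → Uniform f → Decomposition i j f → 0 < support f →
            Bounded i (n ∸ j) (support f)

  bound-zero : Bound 0
  bound-zero zero    zero    f _ _ _ |f|>0 =
    ℕ.≤-trans |f|>0 (ℕ.≤-reflexive (sym (ℕ.+-identityʳ (support f))))
  bound-zero (suc i) zero    f _ _ d |f|>0 =
    ⊥-elim (ℕ.<⇒≢ |f|>0 (sym (support-zero (decomposition-empty (ℕ.s≤s ℕ.z≤n) d))))
  bound-zero i       (suc j) f () _ _ _

  module Step {n : ℕ} (IH : Bound n) {i j : ℕ} (f : Fun (suc n)) (j≤1+n : j ≤ suc n)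
              (uniform : Uniform f) (d : Decomposition i j f) (|f|>0 : 0 < support f) where

    l k : Fin q
    l = proj₁ (uniform Fin.zero)
    k = punchIn l Fin.zero

    g h : Fun n
    g = slice f k
    h = slice f l

    off-l : ∀ a → a ≢ l → slice f a ≗ g
    off-l a a≢l = proj₂ (uniform Fin.zero) a k a≢l (Fin.punchInᵢ≢i l Fin.zero)

    S B : Fun n
    S = sliceSum f
    B = sliceDiff f l k

    S≡h+pg : ∀ y → S y ≡ h y ℚ.+ ι (+ p) ℚ.* g y
    S≡h+pg y = trans (ℚΣ.sum-except (λ a → f (a ∷ y)) l (λ a a≢l → off-l a a≢l y))
                     (cong (h y ℚ.+_) (sum-const p (g y)))

    |f|≡|h|+p|g| : support f ≡ support h + p * support g
    |f|≡|h|+p|g| = begin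
      support f                                   ≡⟨ support-∷ f ⟩
      ℕΣ.sum (λ a → support (slice f a))          ≡⟨ ℕΣ.sum-except _ l (λ a a≢l →
                                                       support-cong-≗ (off-l a a≢l)) ⟩
      support h + ℕΣ.sum {p} (const (support g))  ≡⟨ cong (λ s → support h + s)
                                                       (ℕ-sum-const p (support g)) ⟩
      support h + p * support g                   ∎
      where open ≡-Reasoning

    |S|≤|g|+|h| : support S ≤ support g + support h
    |S|≤|g|+|h| = support-subadditive S g h (λ y g≡0 h≡0 →
      trans (S≡h+pg y) (trans (cong₂ (λ a b → a ℚ.+ ι (+ p) ℚ.* b) h≡0 g≡0)
                              (trans (ℚ.+-identityˡ _) (ℚ.*-zeroʳ (ι (+ p))))))

    uniform-S : Uniform S
    uniform-S = uniform-sliceMap f sum ℚΣ.sum-cong-≗ uniform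

    uniform-B : Uniform B
    uniform-B = uniform-sliceMap f (λ u → u l ℚ.- u k) (λ u≗v → cong₂ ℚ._-_ (u≗v l) (u≗v k)) uniform

    uniform-S-B : Uniform (λ y → S y ℚ.- B y)
    uniform-S-B = uniform-sliceMap f (λ u → sum u ℚ.- (u l ℚ.- u k))
      (λ u≗v → cong₂ ℚ._-_ (ℚΣ.sum-cong-≗ u≗v) (cong₂ ℚ._-_ (u≗v l) (u≗v k))) uniform

    dS : Decomposition i j S
    dS = decomposition-sliceSum d

    dB : Decomposition (ℕ.pred i) (ℕ.pred j) B
    dB = decomposition-sliceDiff d l k

    impossible : ∀ {P : Set} → (P → support f ≡ 0) → ¬ P
    impossible P⇒|f|≡0 x = ℕ.<⇒≢ |f|>0 (sym (P⇒|f|≡0 x))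

    module _ (S≡0 : S ≗ const 0ℚ) where

      h≡-pg : ∀ y → h y ≡ (ℚ.- ι (+ p)) ℚ.* g y
      h≡-pg y = begin
        h y                                                 ≡⟨ isolate (h y) (ι (+ p)) (g y) ⟩
        (h y ℚ.+ ι (+ p) ℚ.* g y) ℚ.+ (ℚ.- ι (+ p)) ℚ.* g y ≡⟨ cong (ℚ._+ (ℚ.- ι (+ p)) ℚ.* g y)
                                                                (trans (sym (S≡h+pg y)) (S≡0 y)) ⟩
        0ℚ ℚ.+ (ℚ.- ι (+ p)) ℚ.* g y                        ≡⟨ ℚ.+-identityˡ _ ⟩
        (ℚ.- ι (+ p)) ℚ.* g y                               ∎
        where
          open ≡-Reasoning
          isolate : ∀ x c y → x ≡ (x ℚ.+ c ℚ.* y) ℚ.+ (ℚ.- c) ℚ.* y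
          isolate = solve 3 (λ x c y → x := (x :+ c :* y) :+ (:- c) :* y) refl

      B≡-qg : ∀ y → B y ≡ (ℚ.- ι (+ q)) ℚ.* g y
      B≡-qg y = begin
        h y ℚ.- g y                        ≡⟨ cong (ℚ._- g y) (h≡-pg y) ⟩
        (ℚ.- ι (+ p)) ℚ.* g y ℚ.- g y      ≡⟨ collect (ι (+ p)) (g y) ⟩
        (ℚ.- (ℚ.1ℚ ℚ.+ ι (+ p))) ℚ.* g y   ≡⟨ cong (λ c → (ℚ.- c) ℚ.* g y)
                                                 (ι-homo-+ (+ 1) (+ p)) ⟨
        (ℚ.- ι (+ q)) ℚ.* g y              ∎
        where
          open ≡-Reasoning
          collect : ∀ c y → (ℚ.- c) ℚ.* y ℚ.- y ≡ (ℚ.- (ℚ.1ℚ ℚ.+ c)) ℚ.* y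
          collect = solve 2 (λ c y → (:- c) :* y :- y := (:- (con ℚ.1ℚ :+ c)) :* y) refl

      |f|≡q|B| : support f ≡ q * support B
      |f|≡q|B| = begin
        support f                  ≡⟨ |f|≡|h|+p|g| ⟩
        support h + p * support g  ≡⟨ cong (λ s → s + p * support g)
                                        (support-scale h g (neg-nonZero (ι-nonZero r)) h≡-pg) ⟩
        q * support g              ≡⟨ cong (q *_)
                                        (support-scale B g (neg-nonZero (ι-nonZero p)) B≡-qg) ⟨
        q * support B              ∎
        where open ≡-Reasoning

      bound-if-S-vanishes : Bounded i (suc n ∸ j) (support f)
      bound-if-S-vanishes = subst₂ (Bounded i) (sym (suc∸≡∸pred n j≢0)) (sym |f|≡q|B|)
        (scaled-bound (n ∸ ℕ.pred j) i
          (IH (ℕ.pred i) (ℕ.pred j) B (ℕ.pred-mono-≤ j≤1+n) uniform-B dB |B|>0))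
        where
          |f|≡0-if-|B|≡0 : support B ≡ 0 → support f ≡ 0
          |f|≡0-if-|B|≡0 |B|≡0 = trans |f|≡q|B| (trans (cong (q *_) |B|≡0) (ℕ.*-zeroʳ q))
          |B|>0 : 0 < support B
          |B|>0 = ℕ.n≢0⇒n>0 (impossible |f|≡0-if-|B|≡0)
          j≢0 : j ≢ 0
          j≢0 = impossible (λ j≡0 → |f|≡0-if-|B|≡0 (support-zero (sliceDiff-vanishes d j≡0 l k)))

    bound-if-j≡1+n : 0 < support S → j ≡ suc n → Bounded i (suc n ∸ j) (support f)
    bound-if-j≡1+n |S|>0 j≡1+n = subst (λ j → Bounded i (suc n ∸ j) (support f)) (sym j≡1+n)
      (ℕ.≤-trans (IH i n S ℕ.≤-refl uniform-S (decomposition-top dS) |S|>0)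
                 (ℕ.*-monoʳ-≤ (q ^ (n ∸ n)) |S|≤|f|))
      where
        |S|≤|f| : support S ≤ support f
        |S|≤|f| = begin
          support S                  ≤⟨ |S|≤|g|+|h| ⟩
          support g + support h      ≡⟨ ℕ.+-comm (support g) (support h) ⟩
          support h + support g      ≤⟨ ℕ.+-monoʳ-≤ (support h) (ℕ.m≤n*m (support g) p) ⟩
          support h + p * support g  ≡⟨ |f|≡|h|+p|g| ⟨
          support f                  ∎
          where open ℕ.≤-Reasoning

    bound-if-g≢0 : 0 < support S → j ≤ n → 0 < support g → Bounded i (suc n ∸ j) (support f)
    bound-if-g≢0 |S|>0 j≤n |g|>0 = subst₂ (Bounded i) (sym (ℕ.+-∸-assoc 1 j≤n)) (sym |f|≡|h|+p|g|)
      (combined-bound r (n ∸ j) i (IH i j S j≤n uniform-S dS |S|>0) IH-g |S|≤|g|+|h|)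
      where
        S-B≡qg : ∀ y → S y ℚ.- B y ≡ ι (+ q) ℚ.* g y
        S-B≡qg y = begin
          S y ℚ.- (h y ℚ.- g y)
            ≡⟨ cong (ℚ._- (h y ℚ.- g y)) (S≡h+pg y) ⟩
          (h y ℚ.+ ι (+ p) ℚ.* g y) ℚ.- (h y ℚ.- g y)
            ≡⟨ collect (h y) (ι (+ p)) (g y) ⟩
          (ℚ.1ℚ ℚ.+ ι (+ p)) ℚ.* g y
            ≡⟨ cong (ℚ._* g y) (ι-homo-+ (+ 1) (+ p)) ⟨
          ι (+ q) ℚ.* g y ∎
          where
            open ≡-Reasoning
            collect : ∀ x c y → (x ℚ.+ c ℚ.* y) ℚ.- (x ℚ.- y) ≡ (ℚ.1ℚ ℚ.+ c) ℚ.* y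
            collect = solve 3 (λ x c y → (x :+ c :* y) :- (x :- y) := (con ℚ.1ℚ :+ c) :* y)
                              refl
        |S-B|≡|g| : support (λ y → S y ℚ.- B y) ≡ support g
        |S-B|≡|g| = support-scale (λ y → S y ℚ.- B y) g (ι-nonZero p) S-B≡qg
        d-S-B : Decomposition (ℕ.pred i) j (λ y → S y ℚ.- B y)
        d-S-B = decomposition-sub (decomposition-widen ℕ.pred[n]≤n ℕ.≤-refl dS)
                                  (decomposition-widen ℕ.≤-refl ℕ.pred[n]≤n dB)
        IH-g : Bounded (ℕ.pred i) (n ∸ j) (support g)
        IH-g = subst (Bounded (ℕ.pred i) (n ∸ j)) |S-B|≡|g|
          (IH (ℕ.pred i) j _ j≤n uniform-S-B d-S-B (subst (0 <_) (sym |S-B|≡|g|) |g|>0))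

    bound-if-g≡0 : 0 < support S → g ≗ const 0ℚ → Bounded i (suc n ∸ j) (support f)
    bound-if-g≡0 |S|>0 g≡0 = subst₂ (Bounded i) (sym (suc∸≡∸pred n j≢0)) (sym |f|≡|S|)
      (IH i (ℕ.pred j) S (ℕ.pred-mono-≤ j≤1+n) uniform-S
          (decomposition-inter dS (decomposition-cong B≗S dB)) |S|>0)
      where
        S≗h : S ≗ h
        S≗h y = trans (S≡h+pg y) (trans (cong (λ b → h y ℚ.+ ι (+ p) ℚ.* b) (g≡0 y))
                                        (trans (cong (h y ℚ.+_) (ℚ.*-zeroʳ (ι (+ p))))
                                               (ℚ.+-identityʳ (h y))))
        B≗S : B ≗ S
        B≗S y =
          trans (cong (λ b → h y ℚ.- b) (g≡0 y)) (trans (ℚ.+-identityʳ (h y)) (sym (S≗h y)))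
        |f|≡|S| : support f ≡ support S
        |f|≡|S| = begin
          support f                  ≡⟨ |f|≡|h|+p|g| ⟩
          support h + p * support g  ≡⟨ cong (λ s → support h + p * s) (support-zero g≡0) ⟩
          support h + p * 0          ≡⟨ cong (λ s → support h + s) (ℕ.*-zeroʳ p) ⟩
          support h + 0              ≡⟨ ℕ.+-identityʳ (support h) ⟩
          support h                  ≡⟨ support-cong-≗ S≗h ⟨
          support S                  ∎
          where open ≡-Reasoning
        j≢0 : j ≢ 0
        j≢0 = impossible (λ j≡0 → trans |f|≡|S|
                (support-zero (λ y → trans (sym (B≗S y)) (sliceDiff-vanishes d j≡0 l k y))))

    bound : Bounded i (suc n ∸ j) (support f)
    bound with support S ℕ.≟ 0 | ℕ.m≤n⇒m<n∨m≡n j≤1+n | support g ℕ.≟ 0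
    ... | yes |S|≡0 | _          | _         = bound-if-S-vanishes (support≡0⇒vanishes S |S|≡0)
    ... | no  |S|≢0 | inj₂ j≡1+n | _         = bound-if-j≡1+n (ℕ.n≢0⇒n>0 |S|≢0) j≡1+n
    ... | no  |S|≢0 | inj₁ _     | yes |g|≡0 =
      bound-if-g≡0 (ℕ.n≢0⇒n>0 |S|≢0) (support≡0⇒vanishes g |g|≡0)
    ... | no  |S|≢0 | inj₁ j<1+n | no  |g|≢0 =
      bound-if-g≢0 (ℕ.n≢0⇒n>0 |S|≢0) (ℕ.s≤s⁻¹ j<1+n) (ℕ.n≢0⇒n>0 |g|≢0)

  support-bound : ∀ n → Bound n
  support-bound zero    = bound-zero
  support-bound (suc n) i j f j≤1+n uniform d |f|>0 =
    Step.bound (support-bound n) f j≤1+n uniform d |f|>0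

theorem2 : ∀ (q i j n : ℕ) → 3 ≤ q → i ≤ j → j ≤ n → n ≤ i + j →
    (f : Word q n → ℚ) → Uniform f → InUrange i j f → ¬ (∀ x → f x ≡ 0ℚ) →
    2 ^ (n ∸ j) * (q ∸ 1) ^ (n ∸ j) * q ^ (i + j ∸ n) ≤ support f
theorem2 (suc (suc (suc r))) i j n (ℕ.s≤s (ℕ.s≤s (ℕ.s≤s ℕ.z≤n))) i≤j j≤n n≤i+j
         f uniform f∈U f≢0 =
  ℕ.*-cancelˡ-≤ (q ^ (n ∸ j)) {{ℕ.m^n≢0 q (n ∸ j)}} (begin
    q ^ (n ∸ j) * (2 ^ (n ∸ j) * p ^ (n ∸ j) * q ^ (i + j ∸ n))
      ≡⟨ ^-rearrange 2 p q (n ∸ j) (i + j ∸ n) ⟩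
    (2 * p) ^ (n ∸ j) * q ^ (n ∸ j + (i + j ∸ n))
      ≡⟨ cong (λ e → (2 * p) ^ (n ∸ j) * q ^ e) (∸-+-∸ j≤n n≤i+j) ⟩
    (2 * p) ^ (n ∸ j) * q ^ i
      ≤⟨ support-bound n i j f j≤n uniform (decomposition-from-InUrange i≤j j≤n f∈U) |f|>0 ⟩
    q ^ (n ∸ j) * support f ∎)
  where
    open ℕ.≤-Reasoning
    open SupportBound (suc r)
    open Hamming p
    |f|>0 : 0 < support f
    |f|>0 = ℕ.n≢0⇒n>0 (f≢0 ∘ support≡0⇒vanishes f)
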